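{- Let $A$ and the constructors $c_1,\dots,c_m$ be as in the context, and let $P$ be any formula (property of sets). Then the structural induction schema holds on $A$: $$\bigwedge_{i\le m}\Big(\forall x^i_1\in\bar S^i_1.\ \hat P(x^i_1)\Longrightarrow\cdots\Longrightarrow\forall x^i_{n_i}\in\bar S^i_{n_i}.\ \hat P(x^i_{n_i})\Longrightarrow P(c_i\,x^i_1\cdots x^i_{n_i})\Big)\ \vdash\ \forall x\in A.\ P(x),$$ where $\bar S^i_k$ is $A$ if $S^i_k$ is a self-reference and $S^i_k$ otherwise, and $\hat P(x^i_k)$ is $P(x^i_k)$ if $S^i_k$ is a self-reference and $\top$ (true) otherwise.
   Context: Work in ZF set theory. An ADT specification is a finite family $\{c_i:(S^i_1,\dots,S^i_{n_i})\}_{i\le m}$, where each $S^i_k$ is either a fixed set (a closed term) or a special symbol denoting self-reference. To each constructor $c_i$ a tag $\mathrm{tag}_{c_i}$ is assigned, distinct constructors getting distinct tags. For a set $H$, $F(H)=\bigcup_{i\le m}\{(\mathrm{tag}_{c_i},x_1,\dots,x_{n_i})\mid x_k\in H\text{ if }S^i_k\text{ is a self-reference},\ x_k\in S^i_k\text{ otherwise}\}$, with $(\cdot,\dots,\cdot)$ set-theoretic tuples. Let $f$ be the function on $\mathbb N$ with $f(0)=\emptyset$, $f(n+1)=F(f(n))$, and $A:=\bigcup_{n\in\mathbb N}f(n)$. For each $i$, $c_i$ is the (curried) function in $\bar S^i_1\Rightarrow\cdots\Rightarrow\bar S^i_{n_i}\Rightarrow A$ with $c_i\,x_1\cdots x_{n_i}=(\mathrm{tag}_{c_i},x_1,\dots,x_{n_i})$,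 where $B\Rightarrow C$ is the set of total functions from $B$ to $C$ and juxtaposition denotes iterated function application. -}

module Defs where

open import Data.Nat using (ℕ; zero; suc)
open import Data.Fin using (Fin)
open import Data.List using (List; []; _∷_; foldr)
open import Data.List using (allFin) renaming (map to mapL)
open import Data.Vec using (toList; tabulate)
open import Data.Product using (Σ; _×_; _,_)
open import Data.Sum using (_⊎_)
open import Data.Unit using (⊤)
open import Relation.Nullary using (¬_)
open import Relation.Binary.PropositionalEquality using (_≡_)
open import Function.Definitions using (Injective)

_iff_ : Set → Set → Set
A iff B = (A → B) × (B → A)

-- A model of ZF: a carrier V with membership, equality of sets being
-- Agda's propositional equality (so every predicate respects it), and the
-- ZF axioms in Skolemized form.  The separation and replacement schemata
-- are stated for arbitrary Agda predicates/relations on V (which covers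
-- every formula).
record ZF : Set₁ where
  field
    V   : Set
    _∈_ : V → V → Set
    ext : ∀ {a b} → (∀ z → (z ∈ a) iff (z ∈ b)) → a ≡ b
    ∅       : V
    ∅-empty : ∀ z → ¬ (z ∈ ∅)
    upair      : V → V → V
    upair-spec : ∀ a b z → (z ∈ upair a b) iff ((z ≡ a) ⊎ (z ≡ b))
    ⋃      : V → V
    ⋃-spec : ∀ a z → (z ∈ ⋃ a) iff (Σ V λ y → (y ∈ a) × (z ∈ y))
    𝒫      : V → V
    𝒫-spec : ∀ a z → (z ∈ 𝒫 a) iff (∀ w → w ∈ z → w ∈ a)
    sep      : (V → Set) → V → V
    sep-spec : ∀ P a z → (z ∈ sep P a) iff ((z ∈ a) × P z)
    repl      : (V → V → Set) → V → V
    repl-spec : ∀ R a → (∀ x y y′ → x ∈ a → R x y → R x y′ → y ≡ y′) →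
                ∀ z → (z ∈ repl R a) iff (Σ V λ x → (x ∈ a) × R x z)
    infinity : Σ V λ I → (∅ ∈ I) × (∀ x → x ∈ I → ⋃ (upair x (upair x x)) ∈ I)
    foundation : ∀ a → Σ V (λ x → x ∈ a) →
                 Σ V λ y → (y ∈ a) × (∀ z → z ∈ y → ¬ (z ∈ a))

module ZFNotions (Z : ZF) where
  open ZF Z

  sing : V → V
  sing a = upair a a

  _∪_ : V → V → V
  a ∪ b = ⋃ (upair a b)

  succ : V → V
  succ x = x ∪ sing x

  ⟨_,_⟩ : V → V → V
  ⟨ a , b ⟩ = upair (sing a) (upair a b)

  tup : V → List V → V
  tup t []       = t
  tup t (x ∷ xs) = ⟨ t , tup x xs ⟩

  img : (V → V) → V → V
  img g a = repl (λ x y → y ≡ g x) a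

  -- the set { tup t (x₁ ∷ … ∷ xₙ ∷ []) | x₁ ∈ D₁, …, xₙ ∈ Dₙ }
  TS : V → List V → V
  TS t []       = sing t
  TS t (D ∷ Ds) = img (λ r → ⟨ t , r ⟩) (⋃ (img (λ x → TS x Ds) D))

  ⋃L : List V → V
  ⋃L = foldr _∪_ ∅

  Inductive : V → Set
  Inductive I = (∅ ∈ I) × (∀ x → x ∈ I → succ x ∈ I)

  ω : V
  ω = sep (λ x → ∀ I → Inductive I → x ∈ I) (Data.Product.proj₁ infinity)

  num : ℕ → V
  num zero    = ∅
  num (suc n) = succ (num n)

data Sort (V : Set) : Set where
  self  : Sort V
  fixed : V → Sort V

record Spec (Z : ZF) : Set where
  open ZF Z
  field
    m       : ℕ
    arity   : Fin m → ℕ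
    sort    : (i : Fin m) → Fin (arity i) → Sort V
    tag     : Fin m → V
    tag-inj : Injective _≡_ _≡_ tag

module ADT (Z : ZF) (S : Spec Z) where
  open ZF Z
  open ZFNotions Z
  open Spec S

  ⟦_⟧ : Sort V → V → V
  ⟦ self ⟧    H = H
  ⟦ fixed X ⟧ H = X

  -- F(H) = ⋃ᵢ {(tagᵢ, x₁, …, xₙᵢ) | xₖ ∈ H or xₖ ∈ Sⁱₖ}
  F : V → V
  F H = ⋃L (mapL (λ i → TS (tag i) (toList (tabulate (λ k → ⟦ sort i k ⟧ H))))
                 (allFin m))

  f : ℕ → V
  f zero    = ∅
  f (suc n) = F (f n)

  fset : V
  fset = repl (λ x y → Σ ℕ λ n → (x ≡ num n) × (y ≡ f n)) ω

  A : V
  A = ⋃ fset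

  Sbar : (i : Fin m) → Fin (arity i) → V
  Sbar i k = ⟦ sort i k ⟧ A

  hat : (V → Set) → Sort V → V → Set
  hat P self      x = P x
  hat P (fixed _) x = ⊤

  con : (i : Fin m) → (Fin (arity i) → V) → V
  con i xs = tup (tag i) (toList (tabulate xs))

{-# OPTIONS --safe #-}
-- The set A is the union of the stages f n, so it suffices to prove P on every stage,
-- by induction on n.  An element of f (n + 1) = F (f n) is a constructor application cᵢ x₁ ⋯ xₙᵢ
-- whose recursive arguments lie in f n ⊆ A (where P holds by the induction hypothesis) and whose
-- other arguments lie in the fixed sets; the premise of the schema then gives P (cᵢ x₁ ⋯ xₙᵢ).
-- Since A is built by replacement along num n ↦ f n, reading off its stages needs num to be
-- injective, which follows from foundation (no set is a member of itself).
module Submission where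

open import Defs
open import Data.Fin using (Fin; zero; suc)
open import Data.Nat using (ℕ; zero; suc; _<′_; ≤′-refl; ≤′-step)
open import Data.Nat.Properties using (<-cmp; <⇒<′)
open import Data.List using (List; []; _∷_)
open import Data.List using (allFin) renaming (map to mapL)
open import Data.Vec using (toList; tabulate)
open import Data.Vec.Functional using (Vector) renaming (_∷_ to _∷ᵛ_)
open import Data.Product using (Σ; _×_; _,_; proj₁; proj₂)
open import Data.Sum using (_⊎_; inj₁; inj₂)
open import Data.Unit using (tt)
open import Data.Empty using (⊥-elim)
open import Relation.Nullary using (¬_)
open import Relation.Binary using (tri<; tri≈; tri>)
open import Relation.Binary.PropositionalEquality using (_≡_; refl; sym; trans; cong; subst)
open import Function.Definitions using (Injective)

module ZFProperties (Z : ZF) where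
  open ZF Z
  open ZFNotions Z

  _⊆_ : V → V → Set
  a ⊆ b = ∀ {z} → z ∈ a → z ∈ b

  ∈-upairˡ : ∀ a b → a ∈ upair a b
  ∈-upairˡ a b = proj₂ (upair-spec a b a) (inj₁ refl)

  ∈-upairʳ : ∀ a b → b ∈ upair a b
  ∈-upairʳ a b = proj₂ (upair-spec a b b) (inj₂ refl)

  ∈-sing⁻ : ∀ {a z} → z ∈ sing a → z ≡ a
  ∈-sing⁻ {a} {z} z∈ with proj₁ (upair-spec a a z) z∈
  ... | inj₁ z≡a = z≡a
  ... | inj₂ z≡a = z≡a

  ∈-⋃⁺ : ∀ {a y z} → y ∈ a → z ∈ y → z ∈ ⋃ a
  ∈-⋃⁺ {a} {y} {z} y∈a z∈y = proj₂ (⋃-spec a z) (y , y∈a , z∈y)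

  ∈-∪⁻ : ∀ {a b z} → z ∈ (a ∪ b) → (z ∈ a) ⊎ (z ∈ b)
  ∈-∪⁻ {a} {b} {z} z∈ with proj₁ (⋃-spec (upair a b) z) z∈
  ... | y , y∈ , z∈y with proj₁ (upair-spec a b y) y∈
  ... | inj₁ refl = inj₁ z∈y
  ... | inj₂ refl = inj₂ z∈y

  ∈-succ-self : ∀ a → a ∈ succ a
  ∈-succ-self a = ∈-⋃⁺ (∈-upairʳ a (sing a)) (∈-upairˡ a a)

  ∈-succ⁺ : ∀ {a z} → z ∈ a → z ∈ succ a
  ∈-succ⁺ {a} = ∈-⋃⁺ (∈-upairˡ a (sing a))

  ∉-self : ∀ a → ¬ (a ∈ a)
  ∉-self a a∈a with foundation (sing a) (a , ∈-upairˡ a a)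
  ... | y , y∈ , minimal with ∈-sing⁻ y∈
  ... | refl = minimal a a∈a (∈-upairˡ a a)

  num-mono : ∀ {k n} → k <′ n → num k ∈ num n
  num-mono {k} ≤′-refl    = ∈-succ-self (num k)
  num-mono (≤′-step k<n) = ∈-succ⁺ (num-mono k<n)

  num-injective : Injective _≡_ _≡_ num
  num-injective {k} {n} eq with <-cmp k n
  ... | tri< k<n _ _ = ⊥-elim (∉-self (num k) (subst (num k ∈_) (sym eq) (num-mono (<⇒<′ k<n))))
  ... | tri≈ _ k≡n _ = k≡n
  ... | tri> _ _ n<k = ⊥-elim (∉-self (num n) (subst (num n ∈_) eq (num-mono (<⇒<′ n<k))))

  num∈Inductive : ∀ n {I} → Inductive I → num n ∈ I
  num∈Inductive zero    (∅∈I , _)      = ∅∈I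
  num∈Inductive (suc n) ind@(_ , succ∈I) = succ∈I (num n) (num∈Inductive n ind)

  num∈ω : ∀ n → num n ∈ ω
  num∈ω n = proj₂ (sep-spec _ _ (num n))
    (num∈Inductive n (proj₂ infinity) , λ I ind → num∈Inductive n ind)

  ∈-img⁻ : ∀ g a {z} → z ∈ img g a → Σ V λ x → (x ∈ a) × (z ≡ g x)
  ∈-img⁻ g a {z} =
    proj₁ (repl-spec (λ x y → y ≡ g x) a (λ _ _ _ _ y≡ y′≡ → trans y≡ (sym y′≡)) z)

  ∈-⋃L-map⁻ : ∀ {I : Set} (g : I → V) (is : List I) {z} →
              z ∈ ⋃L (mapL g is) → Σ I λ i → z ∈ g i
  ∈-⋃L-map⁻ g []       {z} z∈ = ⊥-elim (∅-empty z z∈)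
  ∈-⋃L-map⁻ g (i ∷ is)     z∈ with ∈-∪⁻ z∈
  ... | inj₁ z∈gi   = i , z∈gi
  ... | inj₂ z∈rest = ∈-⋃L-map⁻ g is z∈rest

  ∈-TS-∷⁻ : ∀ t D Ds {z} → z ∈ TS t (D ∷ Ds) →
            Σ V λ x → Σ V λ r → (x ∈ D) × (r ∈ TS x Ds) × (z ≡ ⟨ t , r ⟩)
  ∈-TS-∷⁻ t D Ds z∈ with ∈-img⁻ _ _ z∈
  ... | r , r∈ , z≡ with proj₁ (⋃-spec _ r) r∈
  ... | w , w∈ , r∈w with ∈-img⁻ _ _ w∈
  ... | x , x∈D , refl = x , r , x∈D , r∈w , z≡

  ∈-TS-tabulate⁻ : ∀ n (D : Vector V n) t {z} → z ∈ TS t (toList (tabulate D)) →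
                   Σ (Vector V n) λ xs → (∀ k → xs k ∈ D k) × (z ≡ tup t (toList (tabulate xs)))
  ∈-TS-tabulate⁻ zero    D t z∈ = (λ ()) , (λ ()) , ∈-sing⁻ z∈
  ∈-TS-tabulate⁻ (suc n) D t z∈ with ∈-TS-∷⁻ t (D zero) (toList (tabulate (λ k → D (suc k)))) z∈
  ... | x , r , x∈D₀ , r∈ , refl with ∈-TS-tabulate⁻ n (λ k → D (suc k)) x r∈
  ... | xs , xs∈D , refl = x ∷ᵛ xs , x∷xs∈D , refl
    where
      x∷xs∈D : ∀ k → (x ∷ᵛ xs) k ∈ D k
      x∷xs∈D zero    = x∈D₀
      x∷xs∈D (suc k) = xs∈D k

module ADTInduction (Z : ZF) (S : Spec Z) where
  open ZF Z
  open ZFNotions Z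
  open ZFProperties Z
  open Spec S
  open ADT Z S

  StageGraph : V → V → Set
  StageGraph x y = Σ ℕ λ n → (x ≡ num n) × (y ≡ f n)

  StageGraph-functional : ∀ x y y′ → x ∈ ω → StageGraph x y → StageGraph x y′ → y ≡ y′
  StageGraph-functional _ _ _ _ (n , x≡n , y≡fn) (n′ , x≡n′ , y′≡fn′) =
    trans y≡fn (trans (cong f (num-injective {n} {n′} (trans (sym x≡n) x≡n′))) (sym y′≡fn′))

  f⊆A : ∀ n → f n ⊆ A
  f⊆A n = ∈-⋃⁺ (proj₂ (repl-spec StageGraph ω StageGraph-functional (f n))
                       (num n , num∈ω n , n , refl , refl))

  ∈-A⁻ : ∀ {x} → x ∈ A → Σ ℕ λ n → x ∈ f n
  ∈-A⁻ {x} x∈A with proj₁ (⋃-spec fset x) x∈A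
  ... | y , y∈fset , x∈y with proj₁ (repl-spec StageGraph ω StageGraph-functional y) y∈fset
  ... | _ , _ , n , _ , refl = n , x∈y

  ∈-F⁻ : ∀ H {x} → x ∈ F H →
         Σ (Fin m) λ i → Σ (Vector V (arity i)) λ xs →
           (∀ k → xs k ∈ ⟦ sort i k ⟧ H) × (x ≡ con i xs)
  ∈-F⁻ H x∈ with ∈-⋃L-map⁻ _ (allFin m) x∈
  ... | i , x∈ᵢ with ∈-TS-tabulate⁻ (arity i) (λ k → ⟦ sort i k ⟧ H) (tag i) x∈ᵢ
  ... | xs , xs∈ , x≡ = i , xs , xs∈ , x≡

  ⟦⟧-mono : ∀ {H H′} → H ⊆ H′ → ∀ s → ⟦ s ⟧ H ⊆ ⟦ s ⟧ H′
  ⟦⟧-mono H⊆H′ self      = H⊆H′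
  ⟦⟧-mono H⊆H′ (fixed X) = λ x∈X → x∈X

  hat-intro : ∀ (P : V → Set) {H} → (∀ {y} → y ∈ H → P y) →
              ∀ s {y} → y ∈ ⟦ s ⟧ H → hat P s y
  hat-intro P PH self      y∈H = PH y∈H
  hat-intro P PH (fixed X) _   = tt

  ConstructorClosed : (V → Set) → Set
  ConstructorClosed P =
    (i : Fin m) (xs : Vector V (arity i)) →
    (∀ k → xs k ∈ Sbar i k) → (∀ k → hat P (sort i k) (xs k)) → P (con i xs)

  stage-induction : ∀ (P : V → Set) → ConstructorClosed P → ∀ n {x} → x ∈ f n → P x
  stage-induction P closed zero    {x} x∈∅ = ⊥-elim (∅-empty x x∈∅)
  stage-induction P closed (suc n) x∈    with ∈-F⁻ (f n) x∈
  ... | i , xs , xs∈ , refl =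
    closed i xs (λ k → ⟦⟧-mono (f⊆A n) (sort i k) (xs∈ k))
                (λ k → hat-intro P (stage-induction P closed n) (sort i k) (xs∈ k))

  A-induction : ∀ (P : V → Set) → ConstructorClosed P → ∀ x → x ∈ A → P x
  A-induction P closed x x∈A with ∈-A⁻ x∈A
  ... | n , x∈fn = stage-induction P closed n x∈fn

mainTheorem6 : (Z : ZF) (S : Spec Z) (P : ZF.V Z → Set) →
    let open ZF Z in
    let open Spec S in
    let open ADT Z S in
    ((i : Fin m) (xs : Fin (arity i) → V) →
       (∀ k → xs k ∈ Sbar i k) →
       (∀ k → hat P (sort i k) (xs k)) →
       P (con i xs)) →
    ∀ x → x ∈ A → P x
mainTheorem6 Z S = ADTInduction.A-induction Z S
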